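{- For every finite simple undirected graph $G$: $\ell(G)\le \mathrm{VCD}(\mathcal{C}_{con}(G))\le \ell(G)+1$.
   Context: $\mathcal{C}_{con}(G)$ is the concept class over the vertex set $V$ consisting of $\emptyset$ and all nonempty $X\subseteq V$ whose induced subgraph is connected. For a connected graph, $\ell(G)$ is the maximum number of leaves of a spanning tree of $G$; for a graph with connected components $G_1,\dots,G_r$, $\ell(G)=\max_i\ell(G_i)$. $\mathrm{VCD}$ is the Vapnik–Chervonenkis dimension: the largest size of a set $S\subseteq V$ such that every $S'\subseteq S$ equals $S\cap C$ for some concept $C$ of the class. -}

module Defs where

open import Data.Nat using (ℕ; _≤_)
open import Data.Bool using (Bool; true; false; _∧_)
open import Data.Fin using (Fin)
open import Data.Fin.Subset using (Subset; _∈_; _⊆_; _∩_; ∣_∣; Nonempty; ⊥)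
open import Data.Vec using (tabulate; lookup)
open import Data.List using (List; []; _∷_; length)
open import Data.List.Relation.Unary.Unique.Propositional using (Unique)
open import Data.Product using (Σ; ∃; _×_)
open import Data.Sum using (_⊎_)
open import Relation.Binary.PropositionalEquality using (_≡_)
open import Relation.Nullary using (¬_)

EdgeRel : ℕ → Set
EdgeRel n = Fin n → Fin n → Bool

Edge : ∀ {n} → EdgeRel n → Fin n → Fin n → Set
Edge E u v = E u v ≡ true

record Graph (n : ℕ) : Set where
  field
    adj     : EdgeRel n
    symm    : ∀ u v → adj u v ≡ adj v u
    irrefl  : ∀ v → adj v v ≡ false
open Graph public

-- Walks from u to v in the relation E all of whose later vertices lie in K
data Walk {n} (E : EdgeRel n) (K : Subset n) : Fin n → Fin n → Set where
  here : ∀ {u} → Walk E K u u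
  step : ∀ {u w v} → Edge E u w → w ∈ K → Walk E K w v → Walk E K u v

ConnectedOn : ∀ {n} → EdgeRel n → Subset n → Set
ConnectedOn E K = Nonempty K × (∀ u v → u ∈ K → v ∈ K → Walk E K u v)

Chain : ∀ {n} → EdgeRel n → Fin n → List (Fin n) → Fin n → Set
Chain E v []       w = Edge E v w
Chain E v (x ∷ xs) w = Edge E v x × Chain E x xs w

HasCycle : ∀ {n} → EdgeRel n → Set
HasCycle {n} E = Σ (Fin n) λ v → Σ (List (Fin n)) λ xs →
  (2 ≤ length xs) × Unique (v ∷ xs) × Chain E v xs v

IsSpanningTree : ∀ {n} → Graph n → Subset n → EdgeRel n → Set
IsSpanningTree G K T =
  (∀ u v → Edge T u v → Edge (adj G) u v) ×
  (∀ u v → Edge T u v → (u ∈ K × v ∈ K)) ×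
  (∀ u v → T u v ≡ T v u) ×
  ConnectedOn T K ×
  ¬ HasCycle T

degree : ∀ {n} → EdgeRel n → Fin n → ℕ
degree T v = ∣ tabulate (T v) ∣

isOne : ℕ → Bool
isOne 1 = true
isOne _ = false

leaves : ∀ {n} → Subset n → EdgeRel n → ℕ
leaves K T = ∣ tabulate (λ v → lookup K v ∧ isOne (degree T v)) ∣

IsComponent : ∀ {n} → Graph n → Subset n → Set
IsComponent G K = ConnectedOn (adj G) K ×
  (∀ K′ → K ⊆ K′ → ConnectedOn (adj G) K′ → K′ ⊆ K)

-- ℓ(G) = l : maximum over components G_i of the max number of leaves of a
-- spanning tree of G_i (0 if G has no vertices / no components)
IsMaxLeafNumber : ∀ {n} → Graph n → ℕ → Set
IsMaxLeafNumber {n} G l =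
  (∀ K T → IsComponent G K → IsSpanningTree G K T → leaves K T ≤ l) ×
  (l ≡ 0 ⊎ Σ (Subset n) λ K → Σ (EdgeRel n) λ T →
     IsComponent G K × IsSpanningTree G K T × leaves K T ≡ l)

InCcon : ∀ {n} → Graph n → Subset n → Set
InCcon G X = X ≡ ⊥ ⊎ ConnectedOn (adj G) X

Shattered : ∀ {n} → Graph n → Subset n → Set
Shattered {n} G S = ∀ S′ → S′ ⊆ S → Σ (Subset n) λ C → InCcon G C × S ∩ C ≡ S′

IsVCD : ∀ {n} → Graph n → ℕ → Set
IsVCD {n} G d = (Σ (Subset n) λ S → Shattered G S × ∣ S ∣ ≡ d) ×
  (∀ S → Shattered G S → ∣ S ∣ ≤ d)

{-# OPTIONS --safe #-}

-- Lower bound: the leaves L of a spanning tree of a component are shattered, because deleting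
-- leaves keeps a tree connected; for S′ ⊆ L the concept K ∖ (L ∖ S′) cuts out exactly S′.
--
-- Upper bound: fix s₀ in a shattered set S and let S′ = S ∖ {s₀}. Shattering {s₀, s} yields,
-- for every s ∈ S′, a connected set joining s₀ to s that meets S′ only in s. Grow a tree from
-- s₀ through vertices outside S′ as far as possible (the core); every s ∈ S′ is then adjacent
-- to the core and can be hung on it as a leaf. Extending this tree to a spanning tree of the
-- whole component never loses leaves (attaching a pendant vertex x to p creates the leaf x and
-- destroys at most the leaf p), so |S| = 1 + |S′| ≤ 1 + ℓ(G).

module Submission where

open import Defs
open import Data.Nat using (ℕ; suc; _≤_; _<_; z≤n; s≤s)
open import Data.Nat.Properties using (≤-refl; ≤-trans; ≤-reflexive; m≤n⇒m≤1+n; suc-injective)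
open import Data.Bool using (Bool; true; false; _∧_; _∨_)
open import Data.Bool.Properties using (∧-conicalˡ; ∧-conicalʳ; ∨-zeroʳ; ∨-identityʳ)
import Data.Bool.Properties as Bool
open import Data.Fin using (Fin; zero; suc; _≟_)
open import Data.Fin.Properties using (any?)
open import Data.Fin.Subset
  using (Subset; _∈_; _∉_; _⊆_; _⊂_; _⊃_; _∪_; _∩_; _─_; _-_; ⁅_⁆; ⊤; ⊥; ∁; ∣_∣; Nonempty; inside; outside)
open import Data.Fin.Subset.Properties
  using ( _∈?_; nonempty?; Empty-unique; ∣⊥∣≡0; ⊆-antisym; ∈⊤; ∉⊥; x∈⁅x⁆; x∈⁅y⁆⇒x≡y; ∣⁅x⁆∣≡1
        ; p⊆q⇒∣p∣≤∣q∣; x∈p⇒∣p-x∣<∣p∣; x∈p∧x≢y⇒x∈p-y; x∉⁅y⁆⇒x≢y; x∈p∧x∉q⇒x∈p─q; p─q⊆p; p─⊥≡p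
        ; p⊆p∪q; q⊆p∪q; x∈p∪q⁻; x∈p∩q⁺; x∈p∩q⁻; ∩-zeroʳ; x∈∁p⇒x∉p; x∉p⇒x∈∁p; x∈p⇒x∉∁p)
open import Data.Fin.Subset.Induction using (⊃-wellFounded)
open import Data.Vec using (_∷_; here; there; tabulate; lookup)
open import Data.Vec.Properties using (lookup∘tabulate; []=⇒lookup; lookup⇒[]=; tabulate-cong)
open import Data.List using (List; []; _∷_; _++_; length)
import Data.List.Relation.Unary.All as All
open import Data.List.Relation.Unary.Any
  using () renaming (here to hereₗ; there to thereₗ; any? to anyₗ?)
open import Data.List.Relation.Unary.Unique.Propositional using (Unique; _∷_)
open import Data.List.Membership.Propositional using () renaming (_∈_ to _∈ₗ_; _∉_ to _∉ₗ_)
open import Data.List.Membership.Propositional.Properties using (∈-∃++)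
open import Data.List.Relation.Binary.Permutation.Propositional using (_↭_; ↭⇒↭ₛ)
open import Data.List.Relation.Binary.Permutation.Propositional.Properties using (++-comm; ↭-length)
import Data.List.Relation.Binary.Permutation.Setoid.Properties as Permutationₛ
open import Data.Product using (∃; ∃₂; _×_; _,_; proj₁; proj₂)
open import Data.Sum using (_⊎_; inj₁; inj₂)
open import Induction.WellFounded using (Acc; acc)
open import Relation.Binary.PropositionalEquality
  using (_≡_; _≢_; refl; sym; trans; cong; cong₂; subst; ≢-sym; setoid)
open import Relation.Nullary using (¬_; Dec; yes; no; does; contradiction; ¬?)
open import Relation.Nullary.Decidable using (_×-dec_; _⊎-dec_; dec-true; dec-false; does-⇔)
open import Function.Bundles using (mk⇔)

private
  variable
    n : ℕ
    u v w x y a b m p : Fin n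
    xs zs : List (Fin n)
    P K : Subset n
    E E′ : EdgeRel n

∈-tabulate⁺ : {f : Fin n → Bool} → f x ≡ true → x ∈ tabulate f
∈-tabulate⁺ {x = x} {f} fx = lookup⇒[]= x (tabulate f) (trans (lookup∘tabulate f x) fx)

∈-tabulate⁻ : {f : Fin n → Bool} → x ∈ tabulate f → f x ≡ true
∈-tabulate⁻ {x = x} {f} x∈ = trans (sym (lookup∘tabulate f x)) ([]=⇒lookup x∈)

x∈p─q⇒x∉q : ∀ (P Q : Subset n) → x ∈ P ─ Q → x ∉ Q
x∈p─q⇒x∉q (_ ∷ P) (outside ∷ Q) here          ()
x∈p─q⇒x∉q (_ ∷ P) (outside ∷ Q) (there x∈P─Q) (there x∈Q) = x∈p─q⇒x∉q P Q x∈P─Q x∈Q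
x∈p─q⇒x∉q (_ ∷ P) (inside  ∷ Q) (there x∈P─Q) (there x∈Q) = x∈p─q⇒x∉q P Q x∈P─Q x∈Q

∣p∣≤1+∣p-x∣ : ∀ (P : Subset n) x → ∣ P ∣ ≤ suc ∣ P - x ∣
∣p∣≤1+∣p-x∣ (inside  ∷ P) zero    = s≤s (≤-reflexive (cong ∣_∣ (sym (p─⊥≡p P))))
∣p∣≤1+∣p-x∣ (outside ∷ P) zero    = m≤n⇒m≤1+n (≤-reflexive (cong ∣_∣ (sym (p─⊥≡p P))))
∣p∣≤1+∣p-x∣ (inside  ∷ P) (suc x) = s≤s (∣p∣≤1+∣p-x∣ P x)
∣p∣≤1+∣p-x∣ (outside ∷ P) (suc x) = ∣p∣≤1+∣p-x∣ P x

p-y⊆q-x⇒∣p∣≤∣q∣ : ∀ {P Q : Subset n} {x y} → x ∈ Q → P - y ⊆ Q - x → ∣ P ∣ ≤ ∣ Q ∣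
p-y⊆q-x⇒∣p∣≤∣q∣ {P = P} {y = y} x∈Q P-y⊆Q-x =
  ≤-trans (∣p∣≤1+∣p-x∣ P y) (≤-trans (s≤s (p⊆q⇒∣p∣≤∣q∣ P-y⊆Q-x)) (x∈p⇒∣p-x∣<∣p∣ x∈Q))

x∈p⇒0<∣p∣ : x ∈ P → 0 < ∣ P ∣
x∈p⇒0<∣p∣ {x = x} {P} x∈P = subst (_≤ ∣ P ∣) (∣⁅x⁆∣≡1 x) (p⊆q⇒∣p∣≤∣q∣ ⁅x⁆⊆P)
  where
  ⁅x⁆⊆P : ⁅ x ⁆ ⊆ P
  ⁅x⁆⊆P y∈⁅x⁆ = subst (_∈ P) (sym (x∈⁅y⁆⇒x≡y x y∈⁅x⁆)) x∈P

∣p∣≡1⇒x∈p⇒y∈p⇒x≡y : ∣ P ∣ ≡ 1 → x ∈ P → y ∈ P → x ≡ y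
∣p∣≡1⇒x∈p⇒y∈p⇒x≡y {P = P} {x} {y} ∣P∣≡1 x∈P y∈P with x ≟ y
... | yes x≡y = x≡y
... | no  x≢y = contradiction (subst (2 ≤_) ∣P∣≡1 2≤∣P∣) λ { (s≤s ()) }
  where
  2≤∣P∣ : 2 ≤ ∣ P ∣
  2≤∣P∣ = ≤-trans (s≤s (x∈p⇒0<∣p∣ (x∈p∧x≢y⇒x∈p-y y∈P (≢-sym x≢y)))) (x∈p⇒∣p-x∣<∣p∣ x∈P)

neighbours : EdgeRel n → Fin n → Subset n
neighbours T v = tabulate (T v)

leafSet : Subset n → EdgeRel n → Subset n
leafSet K T = tabulate (λ v → lookup K v ∧ isOne (degree T v))

isOne⁺ : ∀ {k} → k ≡ 1 → isOne k ≡ true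
isOne⁺ refl = refl

isOne⁻ : ∀ k → isOne k ≡ true → k ≡ 1
isOne⁻ 1 _ = refl
isOne⁻ 0 ()
isOne⁻ (suc (suc k)) ()

∈-leafSet⁺ : ∀ {K : Subset n} {T v} → v ∈ K → degree T v ≡ 1 → v ∈ leafSet K T
∈-leafSet⁺ v∈K deg≡1 = ∈-tabulate⁺ (cong₂ _∧_ ([]=⇒lookup v∈K) (isOne⁺ deg≡1))

∈-leafSet⁻ : ∀ {K : Subset n} {T v} → v ∈ leafSet K T → v ∈ K × degree T v ≡ 1
∈-leafSet⁻ {K = K} {T} {v} v∈L =
  lookup⇒[]= v K v∈K , isOne⁻ (degree T v) deg≡1
  where
  v∈K : lookup K v ≡ true
  v∈K = ∧-conicalˡ _ _ (∈-tabulate⁻ v∈L)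
  deg≡1 : isOne (degree T v) ≡ true
  deg≡1 = ∧-conicalʳ _ _ (∈-tabulate⁻ v∈L)

degree≡1⇒neighbour-unique : ∀ {T : EdgeRel n} {w a b} → degree T w ≡ 1 → Edge T w a → Edge T w b → a ≡ b
degree≡1⇒neighbour-unique deg≡1 wa wb = ∣p∣≡1⇒x∈p⇒y∈p⇒x≡y deg≡1 (∈-tabulate⁺ wa) (∈-tabulate⁺ wb)

walk-map : ∀ {E E′ : EdgeRel n} {K K′ u v} → (∀ u v → Edge E u v → Edge E′ u v) → K ⊆ K′ →
           Walk E K u v → Walk E′ K′ u v
walk-map E⇒E′ K⊆K′ here             = here
walk-map E⇒E′ K⊆K′ (step e w∈K walk) = step (E⇒E′ _ _ e) (K⊆K′ w∈K) (walk-map E⇒E′ K⊆K′ walk)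

walk-++ : Walk E K u w → Walk E K w v → Walk E K u v
walk-++ here              walk′ = walk′
walk-++ (step e w∈K walk) walk′ = step e w∈K (walk-++ walk walk′)

walk-exit : (A : Subset n) → Walk E K u v → u ∈ A → v ∉ A →
            ∃₂ λ a b → a ∈ A × b ∉ A × b ∈ K × Edge E a b
walk-exit A here u∈A v∉A = contradiction u∈A v∉A
walk-exit A (step {w = w} e w∈K walk) u∈A v∉A with w ∈? A
... | yes w∈A = walk-exit A walk w∈A v∉A
... | no  w∉A = _ , w , u∈A , w∉A , w∈K , e

IsCycle : EdgeRel n → Fin n → List (Fin n) → Set
IsCycle E v xs = 2 ≤ length xs × Unique (v ∷ xs) × Chain E v xs v

chain-++ : ∀ ys → Chain E a ys m → Chain E m zs b → Chain E a (ys ++ m ∷ zs) b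
chain-++ []       am        mb = am , mb
chain-++ (y ∷ ys) (ay , ym) mb = ay , chain-++ ys ym mb

chain-split : ∀ ys → Chain E a (ys ++ m ∷ zs) b → Chain E a ys m × Chain E m zs b
chain-split []       (am , mb) = am , mb
chain-split (y ∷ ys) (ay , yb) = let ym , mb = chain-split ys yb in (ay , ym) , mb

chain-last : ∀ y ys → Chain E a (y ∷ ys) b → ∃ λ c → c ∈ₗ y ∷ ys × Edge E c b
chain-last y []        (_ , yb) = y , hereₗ refl , yb
chain-last y (y′ ∷ ys) (_ , y′b) =
  let c , c∈ , cb = chain-last y′ ys y′b in c , thereₗ c∈ , cb

cycle-rotate : ∀ as bs → IsCycle E v (as ++ x ∷ bs) → IsCycle E x (bs ++ v ∷ as)
cycle-rotate {v = v} {x = x} as bs (len , unique , chain) with chain-split as chain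
... | vx , xv =
  subst (2 ≤_) (suc-injective (↭-length rotation)) len ,
  Permutationₛ.Unique-resp-↭ (setoid _) (↭⇒↭ₛ rotation) unique ,
  chain-++ bs xv vx
  where
  rotation : v ∷ as ++ x ∷ bs ↭ x ∷ bs ++ v ∷ as
  rotation = ++-comm (v ∷ as) (x ∷ bs)

IsSymmetric : EdgeRel n → Set
IsSymmetric E = ∀ u v → E u v ≡ E v u

-- The vertices right after and right before x on the cycle are distinct, yet both equal p.
pendant-not-cycle-base : IsSymmetric E → (∀ {w} → Edge E x w → w ≡ p) → ∀ xs → ¬ IsCycle E x xs
pendant-not-cycle-base symE pendant []           (() , _)
pendant-not-cycle-base symE pendant (a ∷ [])     (s≤s () , _)
pendant-not-cycle-base {x = x} symE pendant (a ∷ c ∷ zs) (_ , _ ∷ a∉ ∷ _ , xa , ax)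
  with chain-last c zs ax
... | d , d∈ , dx = All.lookup a∉ d∈ (trans (pendant xa) (sym (pendant (trans (symE x d) dx))))

pendant-not-on-cycle : IsSymmetric E → (∀ {w} → Edge E x w → w ≡ p) →
                       IsCycle E v xs → x ∉ₗ v ∷ xs
pendant-not-on-cycle symE pendant cycle (hereₗ refl) = pendant-not-cycle-base symE pendant _ cycle
pendant-not-on-cycle symE pendant cycle (thereₗ x∈xs) with ∈-∃++ x∈xs
... | as , bs , refl = pendant-not-cycle-base symE pendant _ (cycle-rotate as bs cycle)

chain-avoiding : (∀ {a b} → a ≢ x → b ≢ x → Edge E′ a b → Edge E a b) →
                 ∀ ys → x ∉ₗ a ∷ ys → b ≢ x → Chain E′ a ys b → Chain E a ys b
chain-avoiding E′⇒E []       x∉ b≢x ab        = E′⇒E (λ a≡x → x∉ (hereₗ (sym a≡x))) b≢x ab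
chain-avoiding E′⇒E (y ∷ ys) x∉ b≢x (ay , yb) =
  E′⇒E (λ a≡x → x∉ (hereₗ (sym a≡x))) (λ y≡x → x∉ (thereₗ (hereₗ (sym y≡x)))) ay ,
  chain-avoiding E′⇒E ys (λ x∈ → x∉ (thereₗ x∈)) b≢x yb

-- Attaching a pendant vertex

Link : Fin n → Fin n → Fin n → Fin n → Set
Link x p u v = (u ≡ x × v ≡ p) ⊎ (u ≡ p × v ≡ x)

link? : (x p u v : Fin n) → Dec (Link x p u v)
link? x p u v = (u ≟ x ×-dec v ≟ p) ⊎-dec (u ≟ p ×-dec v ≟ x)

attach : EdgeRel n → Fin n → Fin n → EdgeRel n
attach T x p u v = T u v ∨ does (link? x p u v)

∨≡true⁻ : ∀ a {b} → a ∨ b ≡ true → a ≡ true ⊎ b ≡ true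
∨≡true⁻ true  _      = inj₁ refl
∨≡true⁻ false b≡true = inj₂ b≡true

does≡true⁻ : ∀ {A : Set} (a? : Dec A) → does a? ≡ true → A
does≡true⁻ (yes a) _  = a
does≡true⁻ (no _)  ()

attach⁻ : ∀ {T : EdgeRel n} {x p u v} → Edge (attach T x p) u v → Edge T u v ⊎ Link x p u v
attach⁻ {T = T} {x} {p} {u} {v} e with ∨≡true⁻ (T u v) e
... | inj₁ uv    = inj₁ uv
... | inj₂ link  = inj₂ (does≡true⁻ (link? x p u v) link)

attach⁺ : ∀ {T : EdgeRel n} {x p u v} → Edge T u v → Edge (attach T x p) u v
attach⁺ {x = x} {p} {u} {v} uv = cong (_∨ does (link? x p u v)) uv

attach-link : ∀ {T : EdgeRel n} {x p u v} → Link x p u v → Edge (attach T x p) u v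
attach-link {T = T} {x} {p} {u} {v} l =
  trans (cong (T u v ∨_) (dec-true (link? x p u v) l)) (∨-zeroʳ (T u v))

link-swap : Link x p u v → Link x p v u
link-swap (inj₁ (u≡x , v≡p)) = inj₂ (v≡p , u≡x)
link-swap (inj₂ (u≡p , v≡x)) = inj₁ (v≡x , u≡p)

attach-symmetric : ∀ {T : EdgeRel n} {x p} → IsSymmetric T → IsSymmetric (attach T x p)
attach-symmetric {x = x} {p} symT u v =
  cong₂ _∨_ (symT u v) (does-⇔ (mk⇔ link-swap link-swap) (link? x p u v) (link? x p v u))

attach-pendant : ∀ {T : EdgeRel n} {x p w} → (∀ {w} → ¬ Edge T x w) → Edge (attach T x p) x w → w ≡ p
attach-pendant {T = T} {x} {p} no-edge xw with attach⁻ {T = T} {x} {p} xw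
... | inj₁ xw′                   = contradiction xw′ no-edge
... | inj₂ (inj₁ (_ , w≡p))      = w≡p
... | inj₂ (inj₂ (x≡p , w≡x))    = trans w≡x x≡p

degree-attach-new : ∀ {T : EdgeRel n} {x p} → (∀ {w} → ¬ Edge T x w) → degree (attach T x p) x ≡ 1
degree-attach-new {T = T} {x} {p} no-edge =
  trans (cong ∣_∣ (⊆-antisym N⊆⁅p⁆ ⁅p⁆⊆N)) (∣⁅x⁆∣≡1 p)
  where
  N⊆⁅p⁆ : neighbours (attach T x p) x ⊆ ⁅ p ⁆
  N⊆⁅p⁆ w∈N = subst (_∈ ⁅ p ⁆) (sym (attach-pendant {T = T} no-edge (∈-tabulate⁻ w∈N))) (x∈⁅x⁆ p)
  ⁅p⁆⊆N : ⁅ p ⁆ ⊆ neighbours (attach T x p) x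
  ⁅p⁆⊆N w∈⁅p⁆ = ∈-tabulate⁺ (attach-link {T = T} (inj₁ (refl , x∈⁅y⁆⇒x≡y p w∈⁅p⁆)))

degree-attach-other : ∀ {T : EdgeRel n} {x p v} → v ≢ x → v ≢ p → degree (attach T x p) v ≡ degree T v
degree-attach-other {T = T} {x} {p} {v} v≢x v≢p =
  cong ∣_∣ (tabulate-cong λ w →
    trans (cong (T v w ∨_) (dec-false (link? x p v w) (no-link w))) (∨-identityʳ (T v w)))
  where
  no-link : ∀ w → ¬ Link x p v w
  no-link w (inj₁ (v≡x , _)) = v≢x v≡x
  no-link w (inj₂ (v≡p , _)) = v≢p v≡p

leaves-attach : ∀ {K : Subset n} {T x p} → x ∉ K → (∀ {w} → ¬ Edge T x w) →
                leaves K T ≤ leaves (K ∪ ⁅ x ⁆) (attach T x p)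
leaves-attach {K = K} {T} {x} {p} x∉K no-edge = p-y⊆q-x⇒∣p∣≤∣q∣ x∈L′ L-p⊆L′-x
  where
  x∈L′ : x ∈ leafSet (K ∪ ⁅ x ⁆) (attach T x p)
  x∈L′ = ∈-leafSet⁺ (q⊆p∪q K ⁅ x ⁆ (x∈⁅x⁆ x)) (degree-attach-new {T = T} no-edge)
  L-p⊆L′-x : leafSet K T - p ⊆ leafSet (K ∪ ⁅ x ⁆) (attach T x p) - x
  L-p⊆L′-x {v} v∈L-p =
    let v∈K , deg≡1 = ∈-leafSet⁻ (p─q⊆p _ _ v∈L-p)
        v≢p = x∉⁅y⁆⇒x≢y (x∈p─q⇒x∉q _ _ v∈L-p)
        v≢x = λ v≡x → x∉K (subst (_∈ K) v≡x v∈K)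
        deg′≡1 = trans (degree-attach-other {T = T} v≢x v≢p) deg≡1
    in x∈p∧x≢y⇒x∈p-y (∈-leafSet⁺ (p⊆p∪q ⁅ x ⁆ v∈K) deg′≡1) v≢x

attach-connected : ∀ {T : EdgeRel n} {K x p} → ConnectedOn T K → p ∈ K →
                   ConnectedOn (attach T x p) (K ∪ ⁅ x ⁆)
attach-connected {T = T} {K} {x} {p} ((k , k∈K) , walks) p∈K =
  (k , p⊆p∪q ⁅ x ⁆ k∈K) , λ u v u∈ v∈ → walk-++ (to-p u∈) (from-p v∈)
  where
  K′ : Subset _
  K′ = K ∪ ⁅ x ⁆
  T′ : EdgeRel _
  T′ = attach T x p
  lift : ∀ {u v} → Walk T K u v → Walk T′ K′ u v
  lift = walk-map (λ _ _ → attach⁺ {T = T}) (p⊆p∪q ⁅ x ⁆)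
  to-p : ∀ {u} → u ∈ K′ → Walk T′ K′ u p
  to-p {u} u∈ with x∈p∪q⁻ K ⁅ x ⁆ u∈
  ... | inj₁ u∈K   = lift (walks u p u∈K p∈K)
  ... | inj₂ u∈⁅x⁆ = subst (λ z → Walk T′ K′ z p) (sym (x∈⁅y⁆⇒x≡y x u∈⁅x⁆))
                       (step (attach-link {T = T} (inj₁ (refl , refl))) (p⊆p∪q ⁅ x ⁆ p∈K) here)
  from-p : ∀ {v} → v ∈ K′ → Walk T′ K′ p v
  from-p {v} v∈ with x∈p∪q⁻ K ⁅ x ⁆ v∈
  ... | inj₁ v∈K   = lift (walks p v p∈K v∈K)
  ... | inj₂ v∈⁅x⁆ = subst (Walk T′ K′ p) (sym (x∈⁅y⁆⇒x≡y x v∈⁅x⁆))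
                       (step (attach-link {T = T} (inj₂ (refl , refl))) (q⊆p∪q K ⁅ x ⁆ (x∈⁅x⁆ x)) here)

attach-acyclic : ∀ {T : EdgeRel n} {x p} → IsSymmetric T → (∀ {w} → ¬ Edge T x w) →
                 ¬ HasCycle T → ¬ HasCycle (attach T x p)
attach-acyclic {T = T} {x} {p} symT no-edge acyclic (v , xs , cycle@(len , unique , chain))
  with anyₗ? (x ≟_) (v ∷ xs)
... | yes x∈ = pendant-not-on-cycle (attach-symmetric symT) (attach-pendant {T = T} no-edge) cycle x∈
... | no  x∉ = acyclic (v , xs , len , unique , chain-avoiding T′⇒T xs x∉ v≢x chain)
  where
  v≢x : v ≢ x
  v≢x v≡x = x∉ (hereₗ (sym v≡x))
  T′⇒T : ∀ {a b} → a ≢ x → b ≢ x → Edge (attach T x p) a b → Edge T a b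
  T′⇒T a≢x b≢x ab with attach⁻ {T = T} ab
  ... | inj₁ ab′               = ab′
  ... | inj₂ (inj₁ (a≡x , _)) = contradiction a≡x a≢x
  ... | inj₂ (inj₂ (_ , b≡x)) = contradiction b≡x b≢x

attach-spanningTree : ∀ {G : Graph n} {K T x p} → IsSpanningTree G K T → x ∉ K → p ∈ K →
                      Edge (adj G) p x → IsSpanningTree G (K ∪ ⁅ x ⁆) (attach T x p)
attach-spanningTree {G = G} {K} {T} {x} {p} (⊆G , ⊆K , symT , connected , acyclic) x∉K p∈K px =
  ⊆G′ , ⊆K′ , attach-symmetric symT , attach-connected connected p∈K ,
  attach-acyclic symT no-edge acyclic
  where
  no-edge : ∀ {w} → ¬ Edge T x w
  no-edge xw = x∉K (proj₁ (⊆K _ _ xw))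
  inK′ : K ⊆ K ∪ ⁅ x ⁆
  inK′ = p⊆p∪q ⁅ x ⁆
  x∈K′ : x ∈ K ∪ ⁅ x ⁆
  x∈K′ = q⊆p∪q K ⁅ x ⁆ (x∈⁅x⁆ x)
  ⊆G′ : ∀ u v → Edge (attach T x p) u v → Edge (adj G) u v
  ⊆G′ u v uv with attach⁻ {T = T} uv
  ... | inj₁ uv′                  = ⊆G u v uv′
  ... | inj₂ (inj₁ (refl , refl)) = trans (symm G x p) px
  ... | inj₂ (inj₂ (refl , refl)) = px
  ⊆K′ : ∀ u v → Edge (attach T x p) u v → u ∈ K ∪ ⁅ x ⁆ × v ∈ K ∪ ⁅ x ⁆
  ⊆K′ u v uv with attach⁻ {T = T} uv
  ... | inj₁ uv′                  = inK′ (proj₁ (⊆K u v uv′)) , inK′ (proj₂ (⊆K u v uv′))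
  ... | inj₂ (inj₁ (refl , refl)) = x∈K′ , inK′ p∈K
  ... | inj₂ (inj₂ (refl , refl)) = inK′ p∈K , x∈K′

-- Greedy extension of a tree

-- T′ arises from T by repeatedly hanging a new vertex of Z as a pendant on a vertex of P, until
-- no edge leads from K′ ∩ P to Z ∖ K′. Vertices outside P never gain neighbours, which is what
-- makes every vertex added outside P a leaf of T′.
record Extension (G : Graph n) (P Z K : Subset n) (T : EdgeRel n) : Set where
  field
    K′          : Subset n
    T′          : EdgeRel n
    spanning    : IsSpanningTree G K′ T′
    K⊆K′        : K ⊆ K′
    K′⊆K∪Z      : K′ ⊆ K ∪ Z
    closed      : ∀ {p x} → p ∈ K′ → p ∈ P → x ∈ Z → Edge (adj G) p x → x ∈ K′
    leaves-mono : leaves K T ≤ leaves K′ T′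
    degree-kept : ∀ {v} → v ∉ P → v ∈ K → degree T′ v ≡ degree T v
    degree-new  : ∀ {v} → v ∉ P → v ∈ K′ → v ∉ K → degree T′ v ≡ 1

Frontier : Graph n → (P Z K : Subset n) → Fin n → Fin n → Set
Frontier G P Z K p x = p ∈ K × p ∈ P × x ∉ K × x ∈ Z × Edge (adj G) p x

frontier? : (G : Graph n) (P Z K : Subset n) → Dec (∃₂ (Frontier G P Z K))
frontier? G P Z K = any? λ p → any? λ x →
  p ∈? K ×-dec p ∈? P ×-dec ¬? (x ∈? K) ×-dec x ∈? Z ×-dec adj G p x Bool.≟ true

extension-refl : ∀ {G : Graph n} {P Z K T} → IsSpanningTree G K T → ¬ ∃₂ (Frontier G P Z K) →
                 Extension G P Z K T
extension-refl {G = G} {P} {Z} {K} {T} tree no-frontier = record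
  { K′ = K ; T′ = T ; spanning = tree ; K⊆K′ = λ v∈K → v∈K ; K′⊆K∪Z = p⊆p∪q Z
  ; closed = closed ; leaves-mono = ≤-refl
  ; degree-kept = λ _ _ → refl ; degree-new = λ _ v∈K v∉K → contradiction v∈K v∉K }
  where
  closed : ∀ {p x} → p ∈ K → p ∈ P → x ∈ Z → Edge (adj G) p x → x ∈ K
  closed {p} {x} p∈K p∈P x∈Z px with x ∈? K
  ... | yes x∈K = x∈K
  ... | no  x∉K = contradiction (p , x , p∈K , p∈P , x∉K , x∈Z , px) no-frontier

extension-attach : ∀ {G : Graph n} {P Z K T p x} → IsSpanningTree G K T → Frontier G P Z K p x →
                   Extension G P Z (K ∪ ⁅ x ⁆) (attach T x p) → Extension G P Z K T
extension-attach {G = G} {P} {Z} {K} {T} {p} {x} tree (p∈K , p∈P , x∉K , x∈Z , px) ext = record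
  { K′ = K′ ; T′ = T′ ; spanning = spanning ; closed = closed
  ; K⊆K′ = λ v∈K → K⊆K′ (p⊆p∪q ⁅ x ⁆ v∈K)
  ; K′⊆K∪Z = K′⊆K∪Z″
  ; leaves-mono = ≤-trans (leaves-attach x∉K no-edge) leaves-mono
  ; degree-kept = λ v∉P v∈K → trans (degree-kept v∉P (p⊆p∪q ⁅ x ⁆ v∈K))
                                     (degree-attach-other {T = T} (≢x v∈K) (≢p v∉P))
  ; degree-new = degree-new″ }
  where
  open Extension ext
  no-edge : ∀ {w} → ¬ Edge T x w
  no-edge xw = x∉K (proj₁ (proj₁ (proj₂ tree) _ _ xw))
  ≢x : ∀ {v} → v ∈ K → v ≢ x
  ≢x v∈K v≡x = x∉K (subst (_∈ K) v≡x v∈K)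
  ≢p : ∀ {v} → v ∉ P → v ≢ p
  ≢p v∉P v≡p = v∉P (subst (_∈ P) (sym v≡p) p∈P)
  K′⊆K∪Z″ : K′ ⊆ K ∪ Z
  K′⊆K∪Z″ v∈K′ with x∈p∪q⁻ (K ∪ ⁅ x ⁆) Z (K′⊆K∪Z v∈K′)
  ... | inj₂ v∈Z = q⊆p∪q K Z v∈Z
  ... | inj₁ v∈K∪x with x∈p∪q⁻ K ⁅ x ⁆ v∈K∪x
  ...   | inj₁ v∈K   = p⊆p∪q Z v∈K
  ...   | inj₂ v∈⁅x⁆ = q⊆p∪q K Z (subst (_∈ Z) (sym (x∈⁅y⁆⇒x≡y x v∈⁅x⁆)) x∈Z)
  degree-new″ : ∀ {v} → v ∉ P → v ∈ K′ → v ∉ K → degree T′ v ≡ 1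
  degree-new″ {v} v∉P v∈K′ v∉K with v ∈? (K ∪ ⁅ x ⁆)
  ... | no  v∉K∪x = degree-new v∉P v∈K′ v∉K∪x
  ... | yes v∈K∪x with x∈p∪q⁻ K ⁅ x ⁆ v∈K∪x
  ...   | inj₁ v∈K   = contradiction v∈K v∉K
  ...   | inj₂ v∈⁅x⁆ with x∈⁅y⁆⇒x≡y x v∈⁅x⁆
  ...     | refl = trans (degree-kept v∉P v∈K∪x) (degree-attach-new {T = T} no-edge)

extend : ∀ {K : Subset n} {T} (G : Graph n) (P Z : Subset n) → IsSpanningTree G K T → Extension G P Z K T
extend G P Z tree = grow tree (⊃-wellFounded _)
  where
  grow : ∀ {K T} → IsSpanningTree G K T → Acc _⊃_ K → Extension G P Z K T
  grow {K} tree (acc smaller) with frontier? G P Z K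
  ... | no  none = extension-refl tree none
  ... | yes (p , x , frontier@(p∈K , _ , x∉K , _ , px)) =
    extension-attach {p = p} {x} tree frontier
      (grow (attach-spanningTree {G = G} tree x∉K p∈K px) (smaller K⊂K∪x))
    where
    K⊂K∪x : K ⊂ K ∪ ⁅ x ⁆
    K⊂K∪x = p⊆p∪q ⁅ x ⁆ , x , q⊆p∪q K ⁅ x ⁆ (x∈⁅x⁆ x) , x∉K

-- Lower bound

connectedOn-map : ∀ {E E′ : EdgeRel n} {K} → (∀ u v → Edge E u v → Edge E′ u v) →
                  ConnectedOn E K → ConnectedOn E′ K
connectedOn-map E⇒E′ (nonempty , walks) =
  nonempty , λ u v u∈K v∈K → walk-map E⇒E′ (λ w∈K → w∈K) (walks u v u∈K v∈K)

-- A vertex outside C is a leaf, so the walk returns from it at once to where it came from.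
walk-skip-pendants : ∀ {T : EdgeRel n} {K C u v} → IsSymmetric T →
                     (∀ {w} → w ∈ K → w ∉ C → degree T w ≡ 1) → v ∈ C → Walk T K u v → Walk T C u v
walk-skip-pendants symT pendant v∈C here = here
walk-skip-pendants {T = T} {C = C} {u} {v} symT pendant v∈C (step {w = w} uw w∈K walk)
  with w ∈? C | walk-skip-pendants symT pendant v∈C walk
... | yes w∈C | walk′ = step uw w∈C walk′
... | no  w∉C | here  = contradiction v∈C w∉C
... | no  w∉C | step ww′ _ walk′ =
  subst (λ z → Walk T C z v)
        (degree≡1⇒neighbour-unique {T = T} (pendant w∈K w∉C) ww′ (trans (symT w u) uw)) walk′

connectedOn-prune : ∀ {T : EdgeRel n} {K C} → IsSymmetric T → ConnectedOn T K → C ⊆ K → Nonempty C →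
                    (∀ {w} → w ∈ K → w ∉ C → degree T w ≡ 1) → ConnectedOn T C
connectedOn-prune symT (_ , walks) C⊆K nonempty pendant =
  nonempty , λ u v u∈C v∈C → walk-skip-pendants symT pendant v∈C (walks u v (C⊆K u∈C) (C⊆K v∈C))

leafSet-shattered : ∀ {G : Graph n} {K T} → IsSpanningTree G K T → Shattered G (leafSet K T)
leafSet-shattered {G = G} {K} {T} (⊆G , _ , symT , connected , _) S′ S′⊆L with nonempty? S′
... | no  empty      = ⊥ , inj₁ refl , trans (∩-zeroʳ _) (sym (Empty-unique empty))
... | yes (s , s∈S′) = C , inj₂ C-connected , ⊆-antisym L∩C⊆S′ S′⊆L∩C
  where
  L : Subset _
  L = leafSet K T
  C : Subset _
  C = K ─ (L ─ S′)
  L∩C⊆S′ : L ∩ C ⊆ S′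
  L∩C⊆S′ {v} v∈L∩C with v ∈? S′
  ... | yes v∈S′ = v∈S′
  ... | no  v∉S′ = contradiction (x∈p∧x∉q⇒x∈p─q (proj₁ (x∈p∩q⁻ L C v∈L∩C)) v∉S′)
                                 (x∈p─q⇒x∉q K (L ─ S′) (proj₂ (x∈p∩q⁻ L C v∈L∩C)))
  S′⊆L∩C : S′ ⊆ L ∩ C
  S′⊆L∩C v∈S′ = x∈p∩q⁺ (S′⊆L v∈S′ , x∈p∧x∉q⇒x∈p─q (proj₁ (∈-leafSet⁻ {K = K} {T} (S′⊆L v∈S′)))
                                        (λ v∈L─S′ → x∈p─q⇒x∉q L S′ v∈L─S′ v∈S′))
  pruned : ∀ {w} → w ∈ K → w ∉ C → degree T w ≡ 1
  pruned {w} w∈K w∉C with w ∈? (L ─ S′)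
  ... | yes w∈L─S′ = proj₂ (∈-leafSet⁻ {K = K} {T} (p─q⊆p L S′ w∈L─S′))
  ... | no  w∉L─S′ = contradiction (x∈p∧x∉q⇒x∈p─q w∈K w∉L─S′) w∉C
  C-connected : ConnectedOn (adj G) C
  C-connected = connectedOn-map ⊆G (connectedOn-prune symT connected (p─q⊆p K _)
                  (s , proj₂ (x∈p∩q⁻ L C (S′⊆L∩C s∈S′))) pruned)

maxLeaf≤VCD : ∀ {G : Graph n} {l d} → IsMaxLeafNumber G l → IsVCD G d → l ≤ d
maxLeaf≤VCD (_ , inj₁ refl) _ = z≤n
maxLeaf≤VCD {G = G} (_ , inj₂ (K , T , _ , tree , leaves≡l)) (_ , bounded) =
  subst (_≤ _) leaves≡l (bounded (leafSet K T) (leafSet-shattered {G = G} tree))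

-- Upper bound

singleton-spanningTree : (G : Graph n) (s : Fin n) → IsSpanningTree G ⁅ s ⁆ (λ _ _ → false)
singleton-spanningTree G s =
  (λ _ _ ()) , (λ _ _ ()) , (λ _ _ → refl) , ((s , x∈⁅x⁆ s) , walks) , no-cycle
  where
  walks : ∀ u v → u ∈ ⁅ s ⁆ → v ∈ ⁅ s ⁆ → Walk (λ _ _ → false) ⁅ s ⁆ u v
  walks u v u∈ v∈ = subst (Walk _ ⁅ s ⁆ u) (trans (x∈⁅y⁆⇒x≡y s u∈) (sym (x∈⁅y⁆⇒x≡y s v∈))) here
  no-cycle : ¬ HasCycle {n} (λ _ _ → false)
  no-cycle (_ , []    , () , _)
  no-cycle (_ , _ ∷ _ , _  , _ , () , _)

closed⇒component : ∀ {G : Graph n} {K T} → IsSpanningTree G K T →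
                   (∀ {u v} → u ∈ K → Edge (adj G) u v → v ∈ K) → IsComponent G K
closed⇒component {G = G} {K} (⊆G , _ , _ , connected , _) closed =
  connectedOn-map ⊆G connected , maximal
  where
  maximal : ∀ K″ → K ⊆ K″ → ConnectedOn (adj G) K″ → K″ ⊆ K
  maximal K″ K⊆K″ (_ , walks) {v} v∈K″ with v ∈? K
  ... | yes v∈K = v∈K
  ... | no  v∉K =
    let k , k∈K = proj₁ connected
        _ , _ , a∈K , b∉K , _ , ab = walk-exit K (walks k v (K⊆K″ k∈K) v∈K″) k∈K v∉K
    in contradiction (closed a∈K ab) b∉K

extend-to-component : ∀ {G : Graph n} {K T} → IsSpanningTree G K T →
                      ∃₂ λ K′ T′ → IsComponent G K′ × IsSpanningTree G K′ T′ × leaves K T ≤ leaves K′ T′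
extend-to-component {G = G} tree =
  K′ , T′ , closed⇒component {G = G} spanning (λ u∈K′ → closed u∈K′ ∈⊤ ∈⊤) , spanning , leaves-mono
  where open Extension (extend G ⊤ ⊤ tree)

module _ {G : Graph n} {S : Subset n} (shattered : Shattered G S) {s₀ : Fin n} (s₀∈S : s₀ ∈ S) where

  private
    S′ : Subset n
    S′ = S - s₀

    s₀∉S′ : s₀ ∉ S′
    s₀∉S′ s₀∈S′ = x∈p─q⇒x∉q S ⁅ s₀ ⁆ s₀∈S′ (x∈⁅x⁆ s₀)

    pair⊆S : ∀ {s} → s ∈ S′ → ⁅ s₀ ⁆ ∪ ⁅ s ⁆ ⊆ S
    pair⊆S {s} s∈S′ w∈pair with x∈p∪q⁻ ⁅ s₀ ⁆ ⁅ s ⁆ w∈pair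
    ... | inj₁ w∈⁅s₀⁆ = subst (_∈ S) (sym (x∈⁅y⁆⇒x≡y s₀ w∈⁅s₀⁆)) s₀∈S
    ... | inj₂ w∈⁅s⁆  = subst (_∈ S) (sym (x∈⁅y⁆⇒x≡y s w∈⁅s⁆)) (p─q⊆p S ⁅ s₀ ⁆ s∈S′)

    connector : ∀ {s} → s ∈ S′ →
                ∃ λ C → ConnectedOn (adj G) C × s₀ ∈ C × s ∈ C × (∀ {w} → w ∈ C → w ∈ S′ → w ≡ s)
    connector {s} s∈S′ with shattered (⁅ s₀ ⁆ ∪ ⁅ s ⁆) (pair⊆S s∈S′)
    ... | C , concept , S∩C≡pair = C , connected concept , s₀∈C , s∈C , only-s
      where
      ∈C : ∀ {w} → w ∈ ⁅ s₀ ⁆ ∪ ⁅ s ⁆ → w ∈ C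
      ∈C w∈pair = proj₂ (x∈p∩q⁻ S C (subst (_ ∈_) (sym S∩C≡pair) w∈pair))
      s₀∈C : s₀ ∈ C
      s₀∈C = ∈C (p⊆p∪q ⁅ s ⁆ (x∈⁅x⁆ s₀))
      s∈C : s ∈ C
      s∈C = ∈C (q⊆p∪q ⁅ s₀ ⁆ ⁅ s ⁆ (x∈⁅x⁆ s))
      connected : InCcon G C → ConnectedOn (adj G) C
      connected (inj₁ C≡⊥)       = contradiction (subst (s₀ ∈_) C≡⊥ s₀∈C) ∉⊥
      connected (inj₂ connected) = connected
      only-s : ∀ {w} → w ∈ C → w ∈ S′ → w ≡ s
      only-s {w} w∈C w∈S′
        with x∈p∪q⁻ ⁅ s₀ ⁆ ⁅ s ⁆ (subst (w ∈_) S∩C≡pair (x∈p∩q⁺ (p─q⊆p S ⁅ s₀ ⁆ w∈S′ , w∈C)))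
      ... | inj₁ w∈⁅s₀⁆ = contradiction (subst (_∈ S′) (x∈⁅y⁆⇒x≡y s₀ w∈⁅s₀⁆) w∈S′) s₀∉S′
      ... | inj₂ w∈⁅s⁆  = x∈⁅y⁆⇒x≡y s w∈⁅s⁆

    core : Extension G ⊤ (∁ S′) ⁅ s₀ ⁆ (λ _ _ → false)
    core = extend G ⊤ (∁ S′) (singleton-spanningTree G s₀)
    module core = Extension core
    fringe : Extension G (∁ S′) S′ core.K′ core.T′
    fringe = extend G (∁ S′) S′ core.spanning
    module fringe = Extension fringe

    core-avoids-S′ : ∀ {v} → v ∈ core.K′ → v ∉ S′
    core-avoids-S′ v∈core with x∈p∪q⁻ ⁅ s₀ ⁆ (∁ S′) (core.K′⊆K∪Z v∈core)
    ... | inj₁ v∈⁅s₀⁆ = subst (_∉ S′) (sym (x∈⁅y⁆⇒x≡y s₀ v∈⁅s₀⁆)) s₀∉S′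
    ... | inj₂ v∈∁S′  = x∈∁p⇒x∉p v∈∁S′

    s₀∈core : s₀ ∈ core.K′
    s₀∈core = core.K⊆K′ (x∈⁅x⁆ s₀)

    -- The core is closed under edges into ∁ S′, so the walk from s₀ to s leaves it through an
    -- edge into S′, whose endpoint can only be s.
    core-neighbour : ∀ {s} → s ∈ S′ → ∃ λ a → a ∈ core.K′ × Edge (adj G) a s
    core-neighbour {s} s∈S′ with connector s∈S′
    ... | C , (_ , walks) , s₀∈C , s∈C , only-s
      with walk-exit core.K′ (walks s₀ s s₀∈C s∈C) s₀∈core (λ s∈core → core-avoids-S′ s∈core s∈S′)
    ... | a , b , a∈core , b∉core , b∈C , ab = a , a∈core , subst (Edge (adj G) a) (only-s b∈C b∈S′) ab
      where
      b∈S′ : b ∈ S′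
      b∈S′ with b ∈? S′
      ... | yes b∈S′ = b∈S′
      ... | no  b∉S′ = contradiction (core.closed a∈core ∈⊤ (x∉p⇒x∈∁p b∉S′) ab) b∉core

    S′⊆fringe-leaves : S′ ⊆ leafSet fringe.K′ fringe.T′
    S′⊆fringe-leaves {s} s∈S′ with core-neighbour s∈S′
    ... | a , a∈core , as =
      ∈-leafSet⁺ s∈fringe (fringe.degree-new (x∈p⇒x∉∁p s∈S′) s∈fringe s∉core)
      where
      s∈fringe : s ∈ fringe.K′
      s∈fringe = fringe.closed (fringe.K⊆K′ a∈core) (x∉p⇒x∈∁p (core-avoids-S′ a∈core)) s∈S′ as
      s∉core : s ∉ core.K′
      s∉core s∈core = core-avoids-S′ s∈core s∈S′

  shattered⇒leafy-component :
    ∃₂ λ K T → IsComponent G K × IsSpanningTree G K T × ∣ S ∣ ≤ suc (leaves K T)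
  shattered⇒leafy-component =
    let K , T , component , tree , fringe≤ = extend-to-component {G = G} fringe.spanning
    in K , T , component , tree ,
       ≤-trans (∣p∣≤1+∣p-x∣ S s₀) (s≤s (≤-trans (p⊆q⇒∣p∣≤∣q∣ S′⊆fringe-leaves) fringe≤))

VCD≤1+maxLeaf : ∀ {G : Graph n} {l d} → IsMaxLeafNumber G l → IsVCD G d → d ≤ suc l
VCD≤1+maxLeaf {n} {G} {l} (bounded , _) ((S , shattered , ∣S∣≡d) , _) =
  subst (_≤ suc l) ∣S∣≡d ∣S∣≤1+l
  where
  ∣S∣≤1+l : ∣ S ∣ ≤ suc l
  ∣S∣≤1+l with nonempty? S
  ... | no  empty       = ≤-trans (≤-reflexive (trans (cong ∣_∣ (Empty-unique empty)) (∣⊥∣≡0 n))) z≤n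
  ... | yes (s₀ , s₀∈S) =
    let K , T , component , tree , ∣S∣≤ = shattered⇒leafy-component {G = G} shattered s₀∈S
    in ≤-trans ∣S∣≤ (s≤s (bounded K T component tree))

corollary2 : ∀ (n : ℕ) (G : Graph n) (l d : ℕ) → IsMaxLeafNumber G l → IsVCD G d → (l ≤ d) × (d ≤ suc l)
corollary2 n G l d maxLeaf vcd = maxLeaf≤VCD {G = G} maxLeaf vcd , VCD≤1+maxLeaf {G = G} maxLeaf vcd
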